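{- $\mathbf{KFr}_{lf}$ is cocomplete and $\mathbf{KFr}_f$ has finite colimits. Moreover, the embedding $\mathbf{KFr}_{lf}\hookrightarrow\mathbf{KFr}$ preserves colimits and the embedding $\mathbf{KFr}_f\hookrightarrow\mathbf{KFr}_{lf}$ preserves finite colimits.
   Context: A Kripke frame is a pair $(P,R)$ with $R\subseteq P\times P$. A p-morphism $f:(P,R)\to(Q,S)$ is a function with $pRp'\Rightarrow f(p)Sf(p')$ and such that $f(p)Sq'$ implies the existence of $p'$ with $pRp'$ and $f(p')=q'$. $\mathbf{KFr}$ is the category of Kripke frames and p-morphisms. $(P,R)$ is locally finite if $\{q\mid pR^*q\}$ is finite for all $p$, where $R^*$ is the reflexive-transitive closure of $R$. $\mathbf{KFr}_{lf}$ and $\mathbf{KFr}_f$ are the full subcategories of $\mathbf{KFr}$ on the locally finite and on the finite Kripke frames respectively. -}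

module Defs where

open import Level using (0ℓ)
open import Data.Nat using (ℕ)
open import Data.Fin using (Fin)
open import Data.Product using (Σ; Σ-syntax; ∃; _×_; _,_)
open import Relation.Binary.Bundles using (Setoid)
open import Relation.Binary.Construct.Closure.ReflexiveTransitive using (Star)

-- Kripke frames (carriers are setoids, since Agda has no quotient types)

record Frame : Set₁ where
  field
    carrier : Setoid 0ℓ 0ℓ
  open Setoid carrier public renaming (Carrier to P)
  field
    R       : P → P → Set
    R-resp  : ∀ {p p' q q'} → p ≈ p' → q ≈ q' → R p q → R p' q'

open Frame public

record PMor (F G : Frame) : Set where
  private
    module F = Frame F
    module G = Frame G
  field
    fun   : F.P → G.P
    cong  : ∀ {p q} → p F.≈ q → fun p G.≈ fun q
    forth : ∀ {p p'} → F.R p p' → G.R (fun p) (fun p')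
    back  : ∀ {p q'} → G.R (fun p) q' → Σ[ p' ∈ F.P ] (F.R p p' × fun p' G.≈ q')

open PMor public

_≐_ : ∀ {F G} → PMor F G → PMor F G → Set
_≐_ {F} {G} f g = ∀ (p : P F) → Frame._≈_ G (fun f p) (fun g p)

idP : ∀ {F} → PMor F F
idP {F} = record
  { fun = λ p → p ; cong = λ e → e ; forth = λ r → r
  ; back = λ {p} {q'} r → q' , r , Frame.refl F }

_∘P_ : ∀ {F G H} → PMor G H → PMor F G → PMor F H
_∘P_ {F} {G} {H} g f = record
  { fun = λ p → fun g (fun f p)
  ; cong = λ e → cong g (cong f e)
  ; forth = λ r → forth g (forth f r)
  ; back = λ {p} {q'} r → bk p q' r }
  where
  bk : ∀ p q' → R H (fun g (fun f p)) q' → Σ[ p' ∈ P F ] (R F p p' × Frame._≈_ H (fun g (fun f p')) q')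
  bk p q' r with back g r
  ... | y , ry , ey with back f ry
  ... | x , rx , ex = x , rx , Frame.trans H (cong g ex) ey

Finite : Frame → Set
Finite F = Σ[ n ∈ ℕ ] Σ[ e ∈ (Fin n → P F) ] (∀ (p : P F) → Σ[ i ∈ Fin n ] Frame._≈_ F p (e i))

LocallyFinite : Frame → Set
LocallyFinite F = ∀ (p : P F) →
  Σ[ n ∈ ℕ ] Σ[ e ∈ (Fin n → P F) ]
    ((∀ i → Star (R F) p (e i)) ×
     (∀ q → Star (R F) p q → Σ[ i ∈ Fin n ] Frame._≈_ F q (e i)))

record SmallCat : Set₁ where
  field
    Obj  : Set
    Hom  : Obj → Obj → Setoid 0ℓ 0ℓ
  HomT : Obj → Obj → Set
  HomT a b = Setoid.Carrier (Hom a b)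
  _≈H_ : ∀ {a b} → HomT a b → HomT a b → Set
  _≈H_ {a} {b} = Setoid._≈_ (Hom a b)
  field
    idH   : ∀ {a} → HomT a a
    _∘H_  : ∀ {a b c} → HomT b c → HomT a b → HomT a c
    ∘-cong : ∀ {a b c} {g g' : HomT b c} {f f' : HomT a b} → g ≈H g' → f ≈H f' → (g ∘H f) ≈H (g' ∘H f')
    idˡ   : ∀ {a b} (f : HomT a b) → (idH ∘H f) ≈H f
    idʳ   : ∀ {a b} (f : HomT a b) → (f ∘H idH) ≈H f
    assoc : ∀ {a b c d} (h : HomT c d) (g : HomT b c) (f : HomT a b) →
            ((h ∘H g) ∘H f) ≈H (h ∘H (g ∘H f))

open SmallCat public

FiniteCat : SmallCat → Set
FiniteCat I =
  (Σ[ n ∈ ℕ ] Σ[ e ∈ (Fin n → Obj I) ] (∀ a → Σ[ i ∈ Fin n ] a ≡' e i)) ×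
  (∀ a b → Σ[ m ∈ ℕ ] Σ[ e ∈ (Fin m → HomT I a b) ] (∀ f → Σ[ i ∈ Fin m ] SmallCat._≈H_ I f (e i)))
  where
  open import Relation.Binary.PropositionalEquality using () renaming (_≡_ to _≡'_)

record Diagram (I : SmallCat) : Set₁ where
  field
    obj    : Obj I → Frame
    hom    : ∀ {a b} → HomT I a b → PMor (obj a) (obj b)
    hom-cong : ∀ {a b} {f g : HomT I a b} → SmallCat._≈H_ I f g → hom f ≐ hom g
    hom-id : ∀ {a} → hom (idH I {a}) ≐ idP
    hom-∘  : ∀ {a b c} (g : HomT I b c) (f : HomT I a b) →
             hom (SmallCat._∘H_ I g f) ≐ (hom g ∘P hom f)

open Diagram public

record Cocone {I : SmallCat} (D : Diagram I) : Set₁ where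
  field
    apex : Frame
    leg  : ∀ a → PMor (obj D a) apex
    commute : ∀ {a b} (f : HomT I a b) → (leg b ∘P hom D f) ≐ leg a

open Cocone public

-- C is a colimit of D in the full subcategory of KFr on frames satisfying Q
-- (C's apex is assumed separately to lie in that subcategory)
IsColimitIn : (Frame → Set) → ∀ {I} {D : Diagram I} → Cocone D → Set₁
IsColimitIn Q {I} {D} C =
  ∀ (C' : Cocone D) → Q (apex C') →
    Σ[ m ∈ PMor (apex C) (apex C') ]
      ((∀ a → (m ∘P leg C a) ≐ leg C' a) ×
       (∀ (m' : PMor (apex C) (apex C')) → (∀ a → (m' ∘P leg C a) ≐ leg C' a) → m' ≐ m))

AnyFrame : Frame → Set
AnyFrame _ = ⊤'
  where open import Data.Unit using () renaming (⊤ to ⊤')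

-- The colimit of a diagram of Kripke frames is the disjoint union of the carriers
-- modulo the equivalence generated by the diagram's maps, with the image of the
-- fibre relations. The legs satisfy the back condition because a successor can be
-- carried along each generating step, forwards by `forth` and backwards by `back`.
-- Every point lies in the image of a leg, and p-morphisms map R*-cones onto
-- R*-cones, so local finiteness is inherited; over a category with finitely many
-- objects, finite frames give a colimit that is a finite union of finite images.
-- As this colimit lies in the respective subcategory, a colimit computed there is
-- isomorphic to it, hence is a colimit in KFr.
module Submission where

open import Defs
open import Level using (0ℓ)
open import Data.Nat using (ℕ)
open import Data.Fin using (Fin)
open import Data.Product using (Σ; Σ-syntax; _×_; _,_; proj₁; proj₂)
open import Data.Unit using (tt)
open import Data.List using (List; length; lookup; tabulate; concat)
open import Data.List.Relation.Unary.Any using (Any; index)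
open import Data.List.Relation.Unary.Any.Properties using (lookup-index; tabulate⁺; concat⁺)
open import Relation.Binary.Bundles using (Setoid)
open import Relation.Binary.PropositionalEquality using (refl)
open import Relation.Binary.Construct.Closure.ReflexiveTransitive using (Star; ε; _◅_; gmap)
open import Relation.Binary.Construct.Closure.Symmetric using (SymClosure; fwd; bwd)
open import Relation.Binary.Construct.Closure.Equivalence as EqClosure using (EqClosure)

module _ {F G : Frame} (g : PMor F G) where
  private
    module F = Frame F
    module G = Frame G

  forth* : ∀ {p q} → Star F.R p q → Star G.R (fun g p) (fun g q)
  forth* = gmap (fun g) (forth g)

  back* : ∀ {p m q} → fun g p G.≈ m → Star G.R m q →
          Σ[ p' ∈ F.P ] (Star F.R p p' × fun g p' G.≈ q)
  back* {p} e ε = p , ε , e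
  back* e (r ◅ rs) with back g (G.R-resp (G.sym e) G.refl r)
  ... | p₁ , r₁ , e₁ with back* e₁ rs
  ... | p' , rs' , e' = p' , r₁ ◅ rs' , e'

LocallyFiniteAt : (F : Frame) → P F → Set
LocallyFiniteAt F p =
  Σ[ n ∈ ℕ ] Σ[ e ∈ (Fin n → P F) ]
    ((∀ i → Star (R F) p (e i)) ×
     (∀ q → Star (R F) p q → Σ[ i ∈ Fin n ] Frame._≈_ F q (e i)))

locallyFiniteAt-image : ∀ {F G} (g : PMor F G) {p} →
                        LocallyFiniteAt F p → LocallyFiniteAt G (fun g p)
locallyFiniteAt-image {G = G} g (n , e , reach , cover) =
  n , (λ i → fun g (e i)) , (λ i → forth* g (reach i)) , cover'
  where
  cover' : ∀ q → Star (R G) (fun g _) q → Σ[ i ∈ Fin n ] Frame._≈_ G q (fun g (e i))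
  cover' q s with back* g (Frame.refl G) s
  ... | p' , s' , e' with cover p' s'
  ... | i , p'≈eᵢ = i , Frame.trans G (Frame.sym G e') (cong g p'≈eᵢ)

finite-fromCovering : ∀ {F} (xs : List (P F)) →
                      (∀ p → Any (Frame._≈_ F p) xs) → Finite F
finite-fromCovering xs cover =
  length xs , lookup xs , λ p → index (cover p) , lookup-index (cover p)

finite-jointImage : ∀ {n} {F : Fin n → Frame} {G} (g : ∀ i → PMor (F i) G) →
                    (∀ i → Finite (F i)) →
                    (∀ q → Σ[ i ∈ Fin n ] Σ[ x ∈ P (F i) ] Frame._≈_ G q (fun (g i) x)) →
                    Finite G
finite-jointImage {G = G} g fin onto =
  finite-fromCovering {G} (concat (tabulate λ i → tabulate λ j → fun (g i) (enum i j))) cover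
  where
  enum : ∀ i → Fin (proj₁ (fin i)) → _
  enum i = proj₁ (proj₂ (fin i))
  cover : ∀ q → Any (Frame._≈_ G q) _
  cover q with onto q
  ... | i , x , q≈gx with proj₂ (proj₂ (fin i)) x
  ... | j , x≈eⱼ = concat⁺ (tabulate⁺ i (tabulate⁺ j (Frame.trans G q≈gx (cong (g i) x≈eⱼ))))

module _ {I : SmallCat} {D : Diagram I} where

  Mediating : (C C' : Cocone D) → PMor (apex C) (apex C') → Set
  Mediating C C' m = ∀ a → (m ∘P leg C a) ≐ leg C' a

  mediating-id : (C : Cocone D) → Mediating C C idP
  mediating-id C a x = Frame.refl (apex C)

  mediating-∘ : ∀ {C C' C''} {m' : PMor (apex C') (apex C'')} {m : PMor (apex C) (apex C')} →
                Mediating C' C'' m' → Mediating C C' m → Mediating C C'' (m' ∘P m)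
  mediating-∘ {C'' = C''} {m'} h' h a x = Frame.trans (apex C'') (cong m' (h a x)) (h' a x)

  colimit⇒colimitIn : ∀ Q (C : Cocone D) → IsColimitIn AnyFrame C → IsColimitIn Q C
  colimit⇒colimitIn Q C colC C' _ = colC C' tt

  colimit-endo≐id : ∀ {Q} {C : Cocone D} → IsColimitIn Q C → Q (apex C) →
                    (m : PMor (apex C) (apex C)) → Mediating C C m → m ≐ idP
  colimit-endo≐id {C = C} colC qC m h p =
    Frame.trans (apex C) (unique m h p) (Frame.sym (apex C) (unique idP (mediating-id C) p))
    where unique = proj₂ (proj₂ (colC C qC))

  -- C and K are isomorphic in the subcategory, so C inherits K's universal property.
  colimitIn⇒colimit : ∀ {Q} (K C : Cocone D) → IsColimitIn AnyFrame K → Q (apex K) →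
                      Q (apex C) → IsColimitIn Q C → IsColimitIn AnyFrame C
  colimitIn⇒colimit {Q} K C colK qK qC colC C' _ =
    u ∘P toK , mediating-∘ {C} {K} {C'} {u} {toK} u-med toK-med , unique
    where
    module C' = Frame (apex C')
    toK : PMor (apex C) (apex K)
    toK = proj₁ (colC K qK)
    toK-med : Mediating C K toK
    toK-med = proj₁ (proj₂ (colC K qK))
    fromK : PMor (apex K) (apex C)
    fromK = proj₁ (colK C tt)
    fromK-med : Mediating K C fromK
    fromK-med = proj₁ (proj₂ (colK C tt))
    u : PMor (apex K) (apex C')
    u = proj₁ (colK C' tt)
    u-med : Mediating K C' u
    u-med = proj₁ (proj₂ (colK C' tt))
    u-unique : ∀ (m : PMor (apex K) (apex C')) → Mediating K C' m → m ≐ u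
    u-unique = proj₂ (proj₂ (colK C' tt))
    round-trip : (fromK ∘P toK) ≐ idP
    round-trip = colimit-endo≐id {Q} {C} colC qC (fromK ∘P toK)
                   (mediating-∘ {C} {K} {C} {fromK} {toK} fromK-med toK-med)
    unique : ∀ (m' : PMor (apex C) (apex C')) → Mediating C C' m' → m' ≐ (u ∘P toK)
    unique m' h p =
      C'.trans (cong m' (Frame.sym (apex C) (round-trip p)))
               (u-unique (m' ∘P fromK) (mediating-∘ {K} {C} {C'} {m'} {fromK} h fromK-med) (fun toK p))

module Colimit {I : SmallCat} (D : Diagram I) where

  Point : Set
  Point = Σ (Obj I) (λ a → P (obj D a))

  Step : Point → Point → Set
  Step (a , x) (b , y) = Σ[ f ∈ HomT I a b ] Frame._≈_ (obj D b) (fun (hom D f) x) y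

  _~_ : Point → Point → Set
  _~_ = EqClosure Step

  pointSetoid : Setoid 0ℓ 0ℓ
  pointSetoid = EqClosure.setoid Step

  open Setoid pointSetoid using () renaming (refl to ~-refl; sym to ~-sym; trans to ~-trans)

  ~-fibre : ∀ a {x y} → Frame._≈_ (obj D a) x y → (a , x) ~ (a , y)
  ~-fibre a x≈y = fwd (idH I , Frame.trans (obj D a) (hom-id D _) x≈y) ◅ ε

  -- No transitive closure is needed: by R-along-~ the legs already satisfy `back`.
  _⇝_ : Point → Point → Set
  u ⇝ v = Σ[ b ∈ Obj I ] Σ[ x ∈ P (obj D b) ] Σ[ y ∈ P (obj D b) ]
            (u ~ (b , x) × R (obj D b) x y × (b , y) ~ v)

  frame : Frame
  frame = record
    { carrier = pointSetoid
    ; R = _⇝_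
    ; R-resp = λ { u≈u' v≈v' (b , x , y , u~x , r , y~v) →
                   b , x , y , ~-trans (~-sym u≈u') u~x , r , ~-trans y~v v≈v' } }

  R-Along : Point → Point → Set
  R-Along (a , x) (b , z) = ∀ {x'} → R (obj D a) x x' →
    Σ[ z' ∈ P (obj D b) ] (R (obj D b) z z' × (a , x') ~ (b , z'))

  R-along-step : ∀ {u v} → SymClosure Step u v → R-Along u v
  R-along-step {v = b , z} (fwd (f , fx≈z)) {x'} r =
    fun (hom D f) x' , R-resp (obj D b) fx≈z (Frame.refl (obj D b)) (forth (hom D f) r) ,
    fwd (f , Frame.refl (obj D b)) ◅ ε
  R-along-step {u = a , x} (bwd (f , fz≈x)) r
    with back (hom D f) (R-resp (obj D a) (Frame.sym (obj D a) fz≈x) (Frame.refl (obj D a)) r)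
  ... | z' , r' , fz'≈x' = z' , r' , bwd (f , fz'≈x') ◅ ε

  R-along-~ : ∀ {u v} → u ~ v → R-Along u v
  R-along-~ ε r = _ , r , ~-refl
  R-along-~ (s ◅ ss) r with R-along-step s r
  ... | y , r₁ , e₁ with R-along-~ ss r₁
  ... | z , r₂ , e₂ = z , r₂ , ~-trans e₁ e₂

  ι : ∀ a → PMor (obj D a) frame
  ι a = record
    { fun = λ x → a , x
    ; cong = ~-fibre a
    ; forth = λ {x} {y} r → a , x , y , ~-refl , r , ~-refl
    ; back = ι-back }
    where
    ι-back : ∀ {x v} → (a , x) ⇝ v → Σ[ x' ∈ P (obj D a) ] (R (obj D a) x x' × (a , x') ~ v)
    ι-back (b , y , y' , x~y , r , y'~v) with R-along-~ (~-sym x~y) r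
    ... | x' , r' , e = x' , r' , ~-trans (~-sym e) y'~v

  cocone : Cocone D
  cocone = record
    { apex = frame
    ; leg = ι
    ; commute = λ {a} {b} f x → bwd (f , Frame.refl (obj D b)) ◅ ε }

  isColimit : IsColimitIn AnyFrame cocone
  isColimit C' _ = u , (λ a x → C'.refl) , (λ u' u'-med (a , x) → u'-med a x)
    where
    module C' = Frame (apex C')
    glue : Point → C'.P
    glue (a , x) = fun (leg C' a) x
    glue-step : ∀ {v w} → SymClosure Step v w → glue v C'.≈ glue w
    glue-step {a , x} {b , y} (fwd (f , fx≈y)) =
      C'.trans (C'.sym (commute C' f x)) (cong (leg C' b) fx≈y)
    glue-step {a , x} {b , y} (bwd (f , fy≈x)) =
      C'.trans (cong (leg C' a) (Frame.sym (obj D a) fy≈x)) (commute C' f y)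
    glue-cong : ∀ {v w} → v ~ w → glue v C'.≈ glue w
    glue-cong ε = C'.refl
    glue-cong (s ◅ ss) = C'.trans (glue-step s) (glue-cong ss)
    u : PMor frame (apex C')
    u = record
      { fun = glue
      ; cong = glue-cong
      ; forth = λ (b , x , y , v~x , r , y~w) →
          C'.R-resp (C'.sym (glue-cong v~x)) (glue-cong y~w) (forth (leg C' b) r)
      ; back = λ {(a , x)} r → let (x' , r' , e) = back (leg C' a) r
                               in (a , x') , (a , x , x' , ~-refl , r' , ~-refl) , e }

  locallyFinite : (∀ a → LocallyFinite (obj D a)) → LocallyFinite frame
  locallyFinite lf (a , x) = locallyFiniteAt-image (ι a) (lf a x)

  finite : FiniteCat I → (∀ a → Finite (obj D a)) → Finite frame
  finite ((n , obj-enum , obj-cover) , _) fin =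
    finite-jointImage (λ i → ι (obj-enum i)) (λ i → fin (obj-enum i)) onto
    where
    onto : ∀ v → Σ[ i ∈ Fin n ] Σ[ x ∈ P (obj D (obj-enum i)) ] v ~ (obj-enum i , x)
    onto (a , x) with obj-cover a
    ... | i , refl = i , x , ~-refl

mainTheorem7 : (∀ (I : SmallCat) (D : Diagram I) → (∀ a → LocallyFinite (obj D a)) →
    Σ[ C ∈ Cocone D ] (LocallyFinite (apex C) × IsColimitIn LocallyFinite C))
    × (∀ (I : SmallCat) (D : Diagram I) → FiniteCat I → (∀ a → Finite (obj D a)) →
    Σ[ C ∈ Cocone D ] (Finite (apex C) × IsColimitIn Finite C))
    × (∀ (I : SmallCat) (D : Diagram I) → (∀ a → LocallyFinite (obj D a)) →
    (C : Cocone D) → LocallyFinite (apex C) → IsColimitIn LocallyFinite C →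
    IsColimitIn AnyFrame C)
    × (∀ (I : SmallCat) (D : Diagram I) → FiniteCat I → (∀ a → Finite (obj D a)) →
    (C : Cocone D) → Finite (apex C) → IsColimitIn Finite C →
    IsColimitIn LocallyFinite C)
mainTheorem7 =
  (λ I D lf → cocone D , locallyFinite D lf , colimit⇒colimitIn LocallyFinite (cocone D) (isColimit D)) ,
  (λ I D fc fin → cocone D , finite D fc fin , colimit⇒colimitIn Finite (cocone D) (isColimit D)) ,
  (λ I D lf C lfC colC → colimitIn⇒colimit (cocone D) C (isColimit D) (locallyFinite D lf) lfC colC) ,
  (λ I D fc fin C finC colC → colimit⇒colimitIn LocallyFinite C
     (colimitIn⇒colimit (cocone D) C (isColimit D) (finite D fc fin) finC colC))
  where open Colimit
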